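{- Let $G$ be a finite simple graph and let $D',D''\subseteq V(G)$ be disjoint minimal sets; put $I=N(D')\cap N(D'')$. If there are domination selectors $\mathcal{D}':D'\to N(D')$ of $D'$ and $\mathcal{D}'':D''\to N(D'')$ of $D''$ such that $\mathcal{D}'(D')\cap I=\emptyset$ and $\mathcal{D}''(D'')\cap I=\emptyset$, then $D=D'\cup D''$ is also minimal.
   Context: $N(v)$ is the open neighborhood of $v$ and $N(S)=\bigcup_{v\in S}N(v)$. A set $D\subseteq V(G)$ is minimal (with respect to open neighborhoods) if there is no proper subset $D'\subsetneq D$ with $N(D')=N(D)$. For a minimal set $D$, a domination selector of $D$ is a function $\mathcal{D}:D\to N(D)$ such that $N(\mathcal{D}(v))\cap D=\{v\}$ for all $v\in D$. -}

module Defs where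

open import Level using (0ℓ)
open import Data.Nat using (ℕ)
open import Data.Fin using (Fin)
open import Data.Product using (Σ; ∃; _×_; _,_)
open import Relation.Nullary using (¬_)
open import Relation.Unary using (Pred; _∈_; _∉_; _⊆_; _∪_; _∩_; Empty)
open import Relation.Binary.PropositionalEquality using (_≡_)

record Graph (n : ℕ) : Set₁ where
  field
    Adj     : Fin n → Fin n → Set
    sym     : ∀ {u v} → Adj u v → Adj v u
    irrefl  : ∀ {v} → ¬ Adj v v

VSet : ℕ → Set₁
VSet n = Pred (Fin n) 0ℓ

module _ {n : ℕ} (G : Graph n) where
  open Graph G

  N : Fin n → VSet n
  N v u = Adj v u

  NS : VSet n → VSet n
  NS S u = ∃ λ v → v ∈ S × u ∈ N v

  _≐_ : VSet n → VSet n → Set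
  A ≐ B = A ⊆ B × B ⊆ A

  _⊊_ : VSet n → VSet n → Set
  A ⊊ B = A ⊆ B × ∃ λ x → x ∈ B × x ∉ A

  Minimal : VSet n → Set₁
  Minimal D = ∀ (D' : VSet n) → D' ⊊ D → ¬ (NS D' ≐ NS D)

  record Selector (D : VSet n) : Set where
    field
      sel    : (v : Fin n) → v ∈ D → Fin n
      sel∈N  : ∀ v (v∈D : v ∈ D) → sel v v∈D ∈ NS D
      unique : ∀ v (v∈D : v ∈ D) (u : Fin n) →
               u ∈ D → u ∈ N (sel v v∈D) → u ≡ v
      self   : ∀ v (v∈D : v ∈ D) → v ∈ N (sel v v∈D)

  Disjoint : VSet n → VSet n → Set
  Disjoint A B = Empty (A ∩ B)

{-# OPTIONS --safe #-}
module Submission where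

open import Defs
open import Data.Nat using (ℕ)
open import Relation.Unary using (_∈_; _∉_; _∪_; _∩_; _⊆_)
open import Data.Product using (_,_)
open import Data.Sum using (inj₁; inj₂)
open import Data.Empty using (⊥-elim)
open import Relation.Binary.PropositionalEquality using (subst)

-- A domination selector gives every v ∈ D a private neighbour 𝒟(v), whose only neighbour
-- in D is v; removing v from D therefore loses 𝒟(v) from N(D), so D is minimal. Under the
-- hypotheses, the selectors of D′ and D″ together form a selector of D′ ∪ D″: a D″-neighbour
-- of 𝒟′(v) would put 𝒟′(v) in I, and symmetrically.

module _ {n : ℕ} (G : Graph n) where
  open Graph G
  open Selector

  NS-monoˡ-∪ : ∀ {A} B → NS G A ⊆ NS G (A ∪ B)
  NS-monoˡ-∪ B (v , v∈A , adj) = v , inj₁ v∈A , adj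

  NS-monoʳ-∪ : ∀ A {B} → NS G B ⊆ NS G (A ∪ B)
  NS-monoʳ-∪ A (v , v∈B , adj) = v , inj₂ v∈B , adj

  Selector⇒Minimal : ∀ {D} → Selector G D → Minimal G D
  Selector⇒Minimal 𝒟 E (E⊆D , x , x∈D , x∉E) (_ , ND⊆NE)
    with ND⊆NE (x , x∈D , sym (self 𝒟 x x∈D))
  ... | y , y∈E , adj = x∉E (subst E (unique 𝒟 x x∈D y (E⊆D y∈E) (sym adj)) y∈E)

  Selector-∪ : ∀ {D′ D″} (𝒟′ : Selector G D′) (𝒟″ : Selector G D″) →
    (∀ v (v∈ : v ∈ D′) → sel 𝒟′ v v∈ ∉ (NS G D′ ∩ NS G D″)) →
    (∀ v (v∈ : v ∈ D″) → sel 𝒟″ v v∈ ∉ (NS G D′ ∩ NS G D″)) →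
    Selector G (D′ ∪ D″)
  Selector-∪ {D′} {D″} 𝒟′ 𝒟″ 𝒟′∉I 𝒟″∉I = record
    { sel    = λ { v (inj₁ v∈) → sel 𝒟′ v v∈ ; v (inj₂ v∈) → sel 𝒟″ v v∈ }
    ; sel∈N  = λ { v (inj₁ v∈) → NS-monoˡ-∪ D″ (sel∈N 𝒟′ v v∈)
                 ; v (inj₂ v∈) → NS-monoʳ-∪ D′ (sel∈N 𝒟″ v v∈) }
    ; unique = λ { v (inj₁ v∈) u (inj₁ u∈) adj → unique 𝒟′ v v∈ u u∈ adj
                 ; v (inj₁ v∈) u (inj₂ u∈) adj →
                     ⊥-elim (𝒟′∉I v v∈ (sel∈N 𝒟′ v v∈ , u , u∈ , sym adj))
                 ; v (inj₂ v∈) u (inj₁ u∈) adj →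
                     ⊥-elim (𝒟″∉I v v∈ ((u , u∈ , sym adj) , sel∈N 𝒟″ v v∈))
                 ; v (inj₂ v∈) u (inj₂ u∈) adj → unique 𝒟″ v v∈ u u∈ adj }
    ; self   = λ { v (inj₁ v∈) → self 𝒟′ v v∈ ; v (inj₂ v∈) → self 𝒟″ v v∈ }
    }

lemma2p11 : {n : ℕ} (G : Graph n) (D′ D″ : VSet n) →
    Minimal G D′ → Minimal G D″ → Disjoint G D′ D″ →
    (𝒟′ : Selector G D′) (𝒟″ : Selector G D″) →
    (∀ v (v∈ : v ∈ D′) → Selector.sel 𝒟′ v v∈ ∉ (NS G D′ ∩ NS G D″)) →
    (∀ v (v∈ : v ∈ D″) → Selector.sel 𝒟″ v v∈ ∉ (NS G D′ ∩ NS G D″)) →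
    Minimal G (D′ ∪ D″)
lemma2p11 G D′ D″ _ _ _ 𝒟′ 𝒟″ 𝒟′∉I 𝒟″∉I =
  Selector⇒Minimal G (Selector-∪ G 𝒟′ 𝒟″ 𝒟′∉I 𝒟″∉I)
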